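{- Let $\ell\geq 2$ be an integer and let $G$ be a graph with girth exactly $2\ell$ and no even hole of length at least $2\ell+2$. Let $H$ be an odd $K_4$-subdivision in $G$. Then there are two ears of $H$ sharing an end which both have length one.
   Context: A hole is an induced cycle of length at least four. A $K_4$-subdivision in $G$ is an induced subgraph $H$ of $G$ isomorphic to a subdivision of $K_4$; its four branch vertices are those of degree $3$, and its six ears are the paths of $H$ corresponding to the edges of $K_4$ (joining two branch vertices, internal vertices of degree $2$ in $H$). The face cycles of $H$ are the four cycles of $H$ corresponding to the four triangles of $K_4$. $H$ is odd if all four face cycles have odd length. -}

module Defs where

open import Data.Nat using (ℕ; zero; suc; _+_; _*_; _≤_)
open import Data.Nat.Divisibility using (_∣_)
import Data.Fin
open Data.Fin using (#_; Fin; toℕ; fromℕ; inject₁)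
open import Data.Product using (Σ; ∃; _×_; _,_)
open import Data.Sum using (_⊎_)
open import Data.Empty using (⊥)
open import Relation.Nullary using (¬_)
open import Relation.Binary.PropositionalEquality using (_≡_; _≢_)
open import Function.Definitions using (Injective)

Even Odd : ℕ → Set
Even k = 2 ∣ k
Odd k = ¬ (2 ∣ k)

record Graph : Set₁ where
  field
    n     : ℕ
    Adj   : Fin n → Fin n → Set
    sym   : ∀ {u v} → Adj u v → Adj v u
    irrefl : ∀ {u} → ¬ Adj u u

module _ (G : Graph) where
  open Graph G

  Consec : (k : ℕ) → Fin k → Fin k → Set
  Consec k i j = (toℕ j ≡ suc (toℕ i)) ⊎ ((suc (toℕ i) ≡ k) × (toℕ j ≡ 0))

  record Cycle (k : ℕ) : Set where
    field
      len≥3 : 3 ≤ k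
      c     : Fin k → Fin n
      inj   : Injective _≡_ _≡_ c
      adj   : ∀ i j → Consec k i j → Adj (c i) (c j)

  record Hole (k : ℕ) : Set where
    field
      cyc   : Cycle k
      len≥4 : 4 ≤ k
      induced : ∀ i j → Adj (Cycle.c cyc i) (Cycle.c cyc j) → Consec k i j ⊎ Consec k j i

  HasGirth : ℕ → Set
  HasGirth g = Cycle g × (∀ k → Cycle k → g ≤ k)

  NoEvenHoleFrom : ℕ → Set
  NoEvenHoleFrom m = ∀ k → m ≤ k → Even k → ¬ Hole k

-- The six edges of K4 on branch indices Fin 4 (= ears of a subdivision).
data Ear : Set where
  e01 e02 e03 e12 e13 e23 : Ear

end₁ end₂ : Ear → Fin 4
end₁ e01 = # 0
end₁ e02 = # 0
end₁ e03 = # 0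
end₁ e12 = # 1
end₁ e13 = # 1
end₁ e23 = # 2
end₂ e01 = # 1
end₂ e02 = # 2
end₂ e03 = # 3
end₂ e12 = # 2
end₂ e13 = # 3
end₂ e23 = # 3

ShareEnd : Ear → Ear → Set
ShareEnd e f = ∃ λ (v : Fin 4) → (v ≡ end₁ e ⊎ v ≡ end₂ e) × (v ≡ end₁ f ⊎ v ≡ end₂ f)

module _ (G : Graph) where
  open Graph G

  record K4Subdivision : Set where
    field
      branch    : Fin 4 → Fin n
      branchInj : Injective _≡_ _≡_ branch
      len       : Ear → ℕ
      len≥1     : ∀ e → 1 ≤ len e
      path      : (e : Ear) → Fin (suc (len e)) → Fin n
      start     : ∀ e → path e Data.Fin.zero ≡ branch (end₁ e)
      finish    : ∀ e → path e (fromℕ (len e)) ≡ branch (end₂ e)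
      pathAdj   : ∀ e (k : Fin (len e)) → Adj (path e (inject₁ k)) (path e (Data.Fin.suc k))
      disjoint  : ∀ e f (x : Fin (suc (len e))) (y : Fin (suc (len f))) →
                  path e x ≡ path f y →
                  (e ≡ f × toℕ x ≡ toℕ y) ⊎
                  ((toℕ x ≡ 0 ⊎ toℕ x ≡ len e) × (toℕ y ≡ 0 ⊎ toℕ y ≡ len f))
      induced   : ∀ e f (x : Fin (suc (len e))) (y : Fin (suc (len f))) →
                  Adj (path e x) (path f y) →
                  ∃ λ g → ∃ λ (k : Fin (len g)) →
                    (path g (inject₁ k) ≡ path e x × path g (Data.Fin.suc k) ≡ path f y) ⊎
                    (path g (inject₁ k) ≡ path f y × path g (Data.Fin.suc k) ≡ path e x)

    -- lengths of the four face cycles (triangle omitting branch vertex 0,1,2,3)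
    face0 face1 face2 face3 : ℕ
    face0 = len e12 + len e13 + len e23
    face1 = len e02 + len e03 + len e23
    face2 = len e01 + len e03 + len e13
    face3 = len e01 + len e02 + len e12

    IsOdd : Set
    IsOdd = Odd face0 × Odd face1 × Odd face2 × Odd face3

{-# OPTIONS --safe #-}
-- Every face cycle of H is a cycle of G of odd length, hence longer than 2ℓ. For each of the three
-- perfect matchings of K₄, the four ears outside it form a cycle of G whose length is the sum of two
-- faces minus twice a shared ear, hence even; if both ears of the matching have length at least 2,
-- this cycle is a hole, so its length is at most 2ℓ + 1. No two matchings can both be like that:
-- their two cycles together are as long as two faces plus twice an ear, which exceeds 2(2ℓ + 1).
-- So two of the three matchings contain an ear of length 1, and ears of distinct matchings always
-- share an end.
module Submission where

open import Defs
open import Data.Nat using (ℕ; _≤_; _*_; _+_)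
open import Data.Product using (∃; _×_)
open import Relation.Binary.PropositionalEquality using (_≡_; _≢_)

open import Data.Nat using (zero; suc; pred; _<_; _∸_; _%_; _<?_; _≤?_; z≤n; s≤s)
open import Data.Nat.Properties
open import Data.Nat.DivMod using (_mod_; %-distribˡ-+; m%n<n; m<n⇒m%n≡m)
open import Data.Nat.Divisibility using (_∣_; m%n≡0⇒n∣m; ∣m+n∣m⇒∣n; m∣m*n)
open import Data.Nat.Tactic.RingSolver using (solve-∀)
open import Data.Fin as Fin using (Fin; toℕ; fromℕ; fromℕ<; inject₁; #_)
open import Data.Fin.Patterns using (0F; 1F; 2F; 3F)
open import Data.Fin.Properties using (toℕ<n; toℕ-fromℕ; toℕ-fromℕ<; toℕ-inject₁; toℕ-injective)
open import Data.Product using (_,_; proj₂; ∃₂)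
open import Data.Sum using (_⊎_; inj₁; inj₂; map₁)
open import Data.Empty using (⊥; ⊥-elim)
open import Data.List using (List; []; _∷_; length)
open import Data.List.Relation.Unary.All using (All; []; _∷_; lookupWith)
open import Data.List.Relation.Unary.AllPairs using (AllPairs; []; _∷_)
open import Data.List.Relation.Unary.Any using (Any; here; there; satisfied)
open import Relation.Nullary using (Dec; yes; no; contradiction)
open import Relation.Binary.PropositionalEquality
  using (refl; sym; trans; cong; cong₂; subst; subst₂; module ≡-Reasoning)

odd⇒%2≡1 : ∀ {m} → Odd m → m % 2 ≡ 1
odd⇒%2≡1 {m} odd with m % 2 in eq | m%n<n m 2
... | 0           | _ = contradiction (m%n≡0⇒n∣m m 2 eq) odd
... | 1           | _ = refl
... | suc (suc _) | s≤s (s≤s ())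

odd+odd-even : ∀ {m n} → Odd m → Odd n → Even (m + n)
odd+odd-even {m} {n} odd-m odd-n = m%n≡0⇒n∣m (m + n) 2 (begin
  (m + n) % 2          ≡⟨ %-distribˡ-+ m n 2 ⟩
  (m % 2 + n % 2) % 2  ≡⟨ cong₂ (λ a b → (a + b) % 2) (odd⇒%2≡1 odd-m) (odd⇒%2≡1 odd-n) ⟩
  0                    ∎)
  where open ≡-Reasoning

even-from-odd-sum : ∀ {x y w h} → Odd x → Odd y → x + y ≡ 2 * w + h → Even h
even-from-odd-sum {w = w} odd-x odd-y eq =
  ∣m+n∣m⇒∣n (subst Even eq (odd+odd-even odd-x odd-y)) (m∣m*n w)

odd∧≥⇒> : ∀ {ℓ f} → Odd f → 2 * ℓ ≤ f → 2 * ℓ < f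
odd∧≥⇒> {ℓ} odd 2ℓ≤f = ≤∧≢⇒< 2ℓ≤f (λ 2ℓ≡f → odd (subst Even 2ℓ≡f (m∣m*n ℓ)))

small+small≢large+large+double : ∀ {x y u v w m} → x ≤ m → y ≤ m → m ≤ u → m ≤ v → 0 < w →
                                 x + y ≢ u + v + 2 * w
small+small≢large+large+double {x} {y} {u} {v} {w} {m} x≤m y≤m m≤u m≤v 0<w = <⇒≢ (begin-strict
  x + y          ≤⟨ +-mono-≤ x≤m y≤m ⟩
  m + m          ≤⟨ +-mono-≤ m≤u m≤v ⟩
  u + v          <⟨ m<m+n (u + v) (≤-trans 0<w (m≤n*m w 2)) ⟩
  u + v + 2 * w  ∎)
  where open ≤-Reasoning

n<m⇒m∸n≡1+[m∸1+n] : ∀ {m n} → n < m → m ∸ n ≡ suc (m ∸ suc n)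
n<m⇒m∸n≡1+[m∸1+n] = +-∸-assoc 1

a+[b+[c+0]]≡a+b+c : ∀ a b c → a + (b + (c + 0)) ≡ a + b + c
a+[b+[c+0]]≡a+b+c = solve-∀

no-step-between-ends : ∀ {L k} → 2 ≤ L → k < L → (k ≡ 0 ⊎ k ≡ L) → (suc k ≡ 0 ⊎ suc k ≡ L) → ⊥
no-step-between-ends 2≤L k<L _          (inj₁ ())
no-step-between-ends 2≤L k<L (inj₁ refl) (inj₂ refl) = <-irrefl refl 2≤L
no-step-between-ends 2≤L k<L (inj₂ refl) (inj₂ _)    = <-irrefl refl k<L

data InRange (m : ℕ) : ℕ → Set where
  toℕ-of : (x : Fin m) → InRange m (toℕ x)

inRange : ∀ {k m} → k < m → InRange m k
inRange k<m = subst (InRange _) (toℕ-fromℕ< k<m) (toℕ-of (fromℕ< k<m))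

data Split (m : ℕ) : ℕ → Set where
  inside : ∀ {o} → o < m → Split m o
  beyond : ∀ o → Split m (m + o)

split : ∀ m o → Split m o
split m o with o <? m
... | yes o<m = inside o<m
... | no o≮m  = subst (Split m) (m+[n∸m]≡n (≮⇒≥ o≮m)) (beyond (o ∸ m))

SameEnds : ∀ {A : Set} → A → A → A → A → Set
SameEnds x y u v = (x ≡ u × y ≡ v) ⊎ (x ≡ v × y ≡ u)

SameEnds-resp : ∀ {A : Set} {x y u v x′ y′ u′ v′ : A} →
                x ≡ x′ → y ≡ y′ → u ≡ u′ → v ≡ v′ → SameEnds x y u v → SameEnds x′ y′ u′ v′
SameEnds-resp refl refl refl refl same = same

SameEnds-trans : ∀ {A : Set} {x y u v s t : A} → SameEnds x y u v → SameEnds u v s t → SameEnds x y s t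
SameEnds-trans (inj₁ (refl , refl)) same = same
SameEnds-trans (inj₂ (refl , refl)) (inj₁ (refl , refl)) = inj₂ (refl , refl)
SameEnds-trans (inj₂ (refl , refl)) (inj₂ (refl , refl)) = inj₁ (refl , refl)

-- Walks in K₄

data OrientedEar : Set where
  _⁺ _⁻ : Ear → OrientedEar

ear : OrientedEar → Ear
ear (e ⁺) = e
ear (e ⁻) = e

source target : OrientedEar → Fin 4
source (e ⁺) = end₁ e
source (e ⁻) = end₂ e
target (e ⁺) = end₂ e
target (e ⁻) = end₁ e

infixr 5 _∷_
data Walk : Fin 4 → Fin 4 → Set where
  []  : ∀ {a} → Walk a a
  _∷_ : ∀ s {b} → Walk (target s) b → Walk (source s) b

steps : ∀ {a b} → Walk a b → List OrientedEar
steps []      = []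
steps (s ∷ w) = s ∷ steps w

Separate : OrientedEar → OrientedEar → Set
Separate s t = source s ≢ source t × ear s ≢ ear t

Simple : ∀ {a b} → Walk a b → Set
Simple w = AllPairs Separate (steps w)

Traverses : ∀ {a b} → Walk a b → Ear → Set
Traverses w g = Any (λ s → ear s ≡ g) (steps w)

faceBase : Fin 4 → Fin 4
faceBase 0F = # 2
faceBase 1F = # 2
faceBase 2F = # 1
faceBase 3F = # 1

-- The face omitting branch vertex v, traversed in the order of the sum faceᵥ of K4Subdivision.
faceWalk : ∀ v → Walk (faceBase v) (faceBase v)
faceWalk 0F = e12 ⁻ ∷ e13 ⁺ ∷ e23 ⁻ ∷ []
faceWalk 1F = e02 ⁻ ∷ e03 ⁺ ∷ e23 ⁻ ∷ []
faceWalk 2F = e01 ⁻ ∷ e03 ⁺ ∷ e13 ⁻ ∷ []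
faceWalk 3F = e01 ⁻ ∷ e02 ⁺ ∷ e12 ⁻ ∷ []

faceWalk-simple : ∀ v → Simple (faceWalk v)
faceWalk-simple 0F = (((λ ()) , (λ ())) ∷ ((λ ()) , (λ ())) ∷ []) ∷ (((λ ()) , (λ ())) ∷ []) ∷ [] ∷ []
faceWalk-simple 1F = (((λ ()) , (λ ())) ∷ ((λ ()) , (λ ())) ∷ []) ∷ (((λ ()) , (λ ())) ∷ []) ∷ [] ∷ []
faceWalk-simple 2F = (((λ ()) , (λ ())) ∷ ((λ ()) , (λ ())) ∷ []) ∷ (((λ ()) , (λ ())) ∷ []) ∷ [] ∷ []
faceWalk-simple 3F = (((λ ()) , (λ ())) ∷ ((λ ()) , (λ ())) ∷ []) ∷ (((λ ()) , (λ ())) ∷ []) ∷ [] ∷ []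

faceWalk-size : ∀ v → 3 ≤ length (steps (faceWalk v))
faceWalk-size 0F = ≤-refl
faceWalk-size 1F = ≤-refl
faceWalk-size 2F = ≤-refl
faceWalk-size 3F = ≤-refl

-- Perfect matchings of K₄

data Matching : Set where
  μ₁ μ₂ μ₃ : Matching

spoke rim : Matching → Ear
spoke μ₁ = e01
spoke μ₂ = e02
spoke μ₃ = e03
rim μ₁ = e23
rim μ₂ = e13
rim μ₃ = e12

partner : Matching → Fin 4
partner μ₁ = # 1
partner μ₂ = # 2
partner μ₃ = # 3

_∈ₘ_ : Ear → Matching → Set
e ∈ₘ m = e ≡ spoke m ⊎ e ≡ rim m

data MatchingPair : Set where
  μ₁₂ μ₁₃ μ₂₃ : MatchingPair

first second : MatchingPair → Matching
first μ₁₂ = μ₁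
first μ₁₃ = μ₁
first μ₂₃ = μ₂
second μ₁₂ = μ₂
second μ₁₃ = μ₃
second μ₂₃ = μ₃

pigeonhole : ∀ {P Q : Matching → Set} → (∀ m → P m ⊎ Q m) →
             (∀ p → Q (first p) → Q (second p) → ⊥) → ∃ λ p → P (first p) × P (second p)
pigeonhole P⊎Q exclusive with P⊎Q μ₁ | P⊎Q μ₂ | P⊎Q μ₃
... | inj₁ p₁ | inj₁ p₂ | _       = μ₁₂ , p₁ , p₂
... | inj₁ p₁ | _       | inj₁ p₃ = μ₁₃ , p₁ , p₃
... | _       | inj₁ p₂ | inj₁ p₃ = μ₂₃ , p₂ , p₃
... | _       | inj₂ q₂ | inj₂ q₃ = ⊥-elim (exclusive μ₂₃ q₂ q₃)
... | inj₂ q₁ | _       | inj₂ q₃ = ⊥-elim (exclusive μ₁₃ q₁ q₃)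
... | inj₂ q₁ | inj₂ q₂ | _       = ⊥-elim (exclusive μ₁₂ q₁ q₂)

third : MatchingPair → Matching
third μ₁₂ = μ₃
third μ₁₃ = μ₂
third μ₂₃ = μ₁

matching-ears-adjacent : ∀ p {e f} → e ∈ₘ first p → f ∈ₘ second p → e ≢ f × ShareEnd e f
matching-ears-adjacent μ₁₂ (inj₁ refl) (inj₁ refl) = (λ ()) , # 0 , inj₁ refl , inj₁ refl
matching-ears-adjacent μ₁₂ (inj₁ refl) (inj₂ refl) = (λ ()) , # 1 , inj₂ refl , inj₁ refl
matching-ears-adjacent μ₁₂ (inj₂ refl) (inj₁ refl) = (λ ()) , # 2 , inj₁ refl , inj₂ refl
matching-ears-adjacent μ₁₂ (inj₂ refl) (inj₂ refl) = (λ ()) , # 3 , inj₂ refl , inj₂ refl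
matching-ears-adjacent μ₁₃ (inj₁ refl) (inj₁ refl) = (λ ()) , # 0 , inj₁ refl , inj₁ refl
matching-ears-adjacent μ₁₃ (inj₁ refl) (inj₂ refl) = (λ ()) , # 1 , inj₂ refl , inj₁ refl
matching-ears-adjacent μ₁₃ (inj₂ refl) (inj₁ refl) = (λ ()) , # 3 , inj₂ refl , inj₂ refl
matching-ears-adjacent μ₁₃ (inj₂ refl) (inj₂ refl) = (λ ()) , # 2 , inj₁ refl , inj₂ refl
matching-ears-adjacent μ₂₃ (inj₁ refl) (inj₁ refl) = (λ ()) , # 0 , inj₁ refl , inj₁ refl
matching-ears-adjacent μ₂₃ (inj₁ refl) (inj₂ refl) = (λ ()) , # 2 , inj₂ refl , inj₂ refl
matching-ears-adjacent μ₂₃ (inj₂ refl) (inj₁ refl) = (λ ()) , # 3 , inj₂ refl , inj₂ refl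
matching-ears-adjacent μ₂₃ (inj₂ refl) (inj₂ refl) = (λ ()) , # 1 , inj₁ refl , inj₁ refl

-- The Hamiltonian cycle of K₄ through the four ears outside the matching.
complement : Matching → Walk (# 0) (# 0)
complement μ₁ = e02 ⁺ ∷ e12 ⁻ ∷ e13 ⁺ ∷ e03 ⁻ ∷ []
complement μ₂ = e01 ⁺ ∷ e12 ⁺ ∷ e23 ⁺ ∷ e03 ⁻ ∷ []
complement μ₃ = e01 ⁺ ∷ e13 ⁺ ∷ e23 ⁻ ∷ e02 ⁻ ∷ []

complement-simple : ∀ m → Simple (complement m)
complement-simple μ₁ =
  (((λ ()) , (λ ())) ∷ ((λ ()) , (λ ())) ∷ ((λ ()) , (λ ())) ∷ []) ∷
  (((λ ()) , (λ ())) ∷ ((λ ()) , (λ ())) ∷ []) ∷ (((λ ()) , (λ ())) ∷ []) ∷ [] ∷ []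
complement-simple μ₂ =
  (((λ ()) , (λ ())) ∷ ((λ ()) , (λ ())) ∷ ((λ ()) , (λ ())) ∷ []) ∷
  (((λ ()) , (λ ())) ∷ ((λ ()) , (λ ())) ∷ []) ∷ (((λ ()) , (λ ())) ∷ []) ∷ [] ∷ []
complement-simple μ₃ =
  (((λ ()) , (λ ())) ∷ ((λ ()) , (λ ())) ∷ ((λ ()) , (λ ())) ∷ []) ∷
  (((λ ()) , (λ ())) ∷ ((λ ()) , (λ ())) ∷ []) ∷ (((λ ()) , (λ ())) ∷ []) ∷ [] ∷ []

complement-size : ∀ m → 4 ≤ length (steps (complement m))
complement-size μ₁ = ≤-refl
complement-size μ₂ = ≤-refl
complement-size μ₃ = ≤-refl

complement-covers : ∀ m g → Traverses (complement m) g ⊎ g ∈ₘ m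
complement-covers μ₁ e01 = inj₂ (inj₁ refl)
complement-covers μ₁ e02 = inj₁ (here refl)
complement-covers μ₁ e03 = inj₁ (there (there (there (here refl))))
complement-covers μ₁ e12 = inj₁ (there (here refl))
complement-covers μ₁ e13 = inj₁ (there (there (here refl)))
complement-covers μ₁ e23 = inj₂ (inj₂ refl)
complement-covers μ₂ e01 = inj₁ (here refl)
complement-covers μ₂ e02 = inj₂ (inj₁ refl)
complement-covers μ₂ e03 = inj₁ (there (there (there (here refl))))
complement-covers μ₂ e12 = inj₁ (there (here refl))
complement-covers μ₂ e13 = inj₂ (inj₂ refl)
complement-covers μ₂ e23 = inj₁ (there (there (here refl)))
complement-covers μ₃ e01 = inj₁ (here refl)
complement-covers μ₃ e02 = inj₁ (there (there (there (here refl))))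
complement-covers μ₃ e03 = inj₂ (inj₁ refl)
complement-covers μ₃ e12 = inj₂ (inj₂ refl)
complement-covers μ₃ e13 = inj₁ (there (here refl))
complement-covers μ₃ e23 = inj₁ (there (there (here refl)))

-- Cycles and holes of G along closed walks of K₄

module Subdivision {G : Graph} (H : K4Subdivision G) where
  open Graph G using (n; Adj) renaming (sym to Adj-sym)
  open K4Subdivision H

  AtEnd : Ear → ℕ → Set
  AtEnd e p = p ≡ 0 ⊎ p ≡ len e

  -- Positions are read modulo len e + 1; only positions p ≤ len e are ever used.
  vertex : Ear → ℕ → Fin n
  vertex e p = path e (p mod suc (len e))

  vertex-toℕ : ∀ e (x : Fin (suc (len e))) → vertex e (toℕ x) ≡ path e x
  vertex-toℕ e x = cong (path e) (toℕ-injective (trans (toℕ-fromℕ< _) (m<n⇒m%n≡m (toℕ<n x))))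

  vertex-inject₁ : ∀ e (k : Fin (len e)) → vertex e (toℕ k) ≡ path e (inject₁ k)
  vertex-inject₁ e k = trans (cong (vertex e) (sym (toℕ-inject₁ k))) (vertex-toℕ e (inject₁ k))

  vertex-start : ∀ e → vertex e 0 ≡ branch (end₁ e)
  vertex-start e = trans (vertex-toℕ e Fin.zero) (start e)

  vertex-finish : ∀ e → vertex e (len e) ≡ branch (end₂ e)
  vertex-finish e = begin
    vertex e (len e)                ≡⟨ cong (vertex e) (sym (toℕ-fromℕ (len e))) ⟩
    vertex e (toℕ (fromℕ (len e)))  ≡⟨ vertex-toℕ e (fromℕ (len e)) ⟩
    path e (fromℕ (len e))          ≡⟨ finish e ⟩
    branch (end₂ e)                 ∎
    where open ≡-Reasoning

  vertex-adjacent : ∀ {e k} → k < len e → Adj (vertex e k) (vertex e (suc k))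
  vertex-adjacent {e} k<len with inRange k<len
  ... | toℕ-of k = subst₂ Adj (sym (vertex-inject₁ e k)) (sym (vertex-toℕ e (Fin.suc k))) (pathAdj e k)

  vertex-disjoint : ∀ {e f p q} → p ≤ len e → q ≤ len f → vertex e p ≡ vertex f q →
                    (e ≡ f × p ≡ q) ⊎ (AtEnd e p × AtEnd f q)
  vertex-disjoint {e} {f} p≤len q≤len eq with inRange (s≤s p≤len) | inRange (s≤s q≤len)
  ... | toℕ-of x | toℕ-of y = disjoint e f x y (trans (sym (vertex-toℕ e x)) (trans eq (vertex-toℕ f y)))

  vertex-induced : ∀ {e f p q} → p ≤ len e → q ≤ len f → Adj (vertex e p) (vertex f q) →
                   ∃₂ λ g k → k < len g × SameEnds (vertex g k) (vertex g (suc k)) (vertex e p) (vertex f q)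
  vertex-induced {e} {f} p≤len q≤len adj with inRange (s≤s p≤len) | inRange (s≤s q≤len)
  ... | toℕ-of x | toℕ-of y with induced e f x y (subst₂ Adj (vertex-toℕ e x) (vertex-toℕ f y) adj)
  ...   | g , k , edge = g , toℕ k , toℕ<n k ,
          SameEnds-resp (sym (vertex-inject₁ g k)) (sym (vertex-toℕ g (Fin.suc k)))
                        (sym (vertex-toℕ e x)) (sym (vertex-toℕ f y)) edge

  stepLength : OrientedEar → ℕ
  stepLength s = len (ear s)

  position : OrientedEar → ℕ → ℕ
  position (e ⁺) o = o
  position (e ⁻) o = len e ∸ o

  stepVertex : OrientedEar → ℕ → Fin n
  stepVertex s o = vertex (ear s) (position s o)

  position-≤ : ∀ s {o} → o ≤ stepLength s → position s o ≤ stepLength s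
  position-≤ (e ⁺) o≤len = o≤len
  position-≤ (e ⁻) {o} _ = m∸n≤m (len e) o

  position-injective : ∀ s {o o′} → o ≤ stepLength s → o′ ≤ stepLength s → position s o ≡ position s o′ → o ≡ o′
  position-injective (e ⁺) _     _      eq = eq
  position-injective (e ⁻) o≤len o′≤len eq = ∸-cancelˡ-≡ o≤len o′≤len eq

  position-atEnd : ∀ s {o} → o < stepLength s → AtEnd (ear s) (position s o) → o ≡ 0
  position-atEnd (e ⁺) o<len (inj₁ o≡0)   = o≡0
  position-atEnd (e ⁺) o<len (inj₂ o≡len) = contradiction o≡len (<⇒≢ o<len)
  position-atEnd (e ⁻) o<len (inj₁ eq)    = contradiction (m∸n≡0⇒m≤n eq) (<⇒≱ o<len)
  position-atEnd (e ⁻) o<len (inj₂ eq)    = ∸-cancelˡ-≡ (<⇒≤ o<len) z≤n eq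

  stepVertex-source : ∀ s → stepVertex s 0 ≡ branch (source s)
  stepVertex-source (e ⁺) = vertex-start e
  stepVertex-source (e ⁻) = vertex-finish e

  stepVertex-target : ∀ s → stepVertex s (stepLength s) ≡ branch (target s)
  stepVertex-target (e ⁺) = vertex-finish e
  stepVertex-target (e ⁻) = trans (cong (vertex e) (n∸n≡0 (len e))) (vertex-start e)

  stepVertex-adjacent : ∀ s {o} → o < stepLength s → Adj (stepVertex s o) (stepVertex s (suc o))
  stepVertex-adjacent (e ⁺) o<len = vertex-adjacent o<len
  stepVertex-adjacent (e ⁻) {o} o<len =
    subst (λ p → Adj (vertex e p) (vertex e (len e ∸ suc o))) (sym (n<m⇒m∸n≡1+[m∸1+n] o<len))
          (Adj-sym (vertex-adjacent (subst (_≤ len e) (n<m⇒m∸n≡1+[m∸1+n] o<len) (m∸n≤m (len e) o))))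

  stepVertex-covers-edge : ∀ s {k} → k < stepLength s → ∃ λ o → o < stepLength s ×
    SameEnds (stepVertex s o) (stepVertex s (suc o)) (vertex (ear s) k) (vertex (ear s) (suc k))
  stepVertex-covers-edge (e ⁺) {k} k<len = k , k<len , inj₁ (refl , refl)
  stepVertex-covers-edge (e ⁻) {k} k<len = len e ∸ suc k , o<len , inj₂ (cong (vertex e) o↦k+1 , cong (vertex e) o+1↦k)
    where
    o<len : len e ∸ suc k < len e
    o<len = subst (_≤ len e) (n<m⇒m∸n≡1+[m∸1+n] k<len) (m∸n≤m (len e) k)
    o↦k+1 : len e ∸ (len e ∸ suc k) ≡ suc k
    o↦k+1 = m∸[m∸n]≡n k<len
    o+1↦k : len e ∸ suc (len e ∸ suc k) ≡ k
    o+1↦k = trans (sym (pred[m∸n]≡m∸[1+n] (len e) (len e ∸ suc k))) (cong pred o↦k+1)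

  stepVertex-injective : ∀ s {o o′} → o < stepLength s → o′ < stepLength s →
                         stepVertex s o ≡ stepVertex s o′ → o ≡ o′
  stepVertex-injective s o<len o′<len eq
    with vertex-disjoint (position-≤ s (<⇒≤ o<len)) (position-≤ s (<⇒≤ o′<len)) eq
  ... | inj₁ (_ , same)   = position-injective s (<⇒≤ o<len) (<⇒≤ o′<len) same
  ... | inj₂ (end , end′) = trans (position-atEnd s o<len end) (sym (position-atEnd s o′<len end′))

  -- Distinct ears meet only in branch vertices, and before its end a step meets only its source.
  separate-steps-disjoint : ∀ {s t o o′} → Separate s t → o < stepLength s → o′ < stepLength t →
                            stepVertex s o ≢ stepVertex t o′
  separate-steps-disjoint {s} {t} (source≢ , ear≢) o<len o′<len eq
    with vertex-disjoint (position-≤ s (<⇒≤ o<len)) (position-≤ t (<⇒≤ o′<len)) eq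
  ... | inj₁ (same-ear , _) = ear≢ same-ear
  ... | inj₂ (end , end′)   = source≢ (branchInj (begin
    branch (source s)  ≡⟨ sym (stepVertex-source s) ⟩
    stepVertex s 0     ≡⟨ subst₂ (λ a b → stepVertex s a ≡ stepVertex t b)
                                 (position-atEnd s o<len end) (position-atEnd t o′<len end′) eq ⟩
    stepVertex t 0     ≡⟨ stepVertex-source t ⟩
    branch (source t)  ∎))
    where open ≡-Reasoning

  walkLength : ∀ {a b} → Walk a b → ℕ
  walkLength []      = 0
  walkLength (s ∷ w) = stepLength s + walkLength w

  steps≤walkLength : ∀ {a b} (w : Walk a b) → length (steps w) ≤ walkLength w
  steps≤walkLength []      = z≤n
  steps≤walkLength (s ∷ w) = +-mono-≤ (len≥1 (ear s)) (steps≤walkLength w)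

  -- Positions past the end of the walk all give its last vertex.
  walkVertex : ∀ {a b} → Walk a b → ℕ → Fin n
  walkVertex {b = b} [] o = branch b
  walkVertex (s ∷ w) o with o <? stepLength s
  ... | yes _ = stepVertex s o
  ... | no _  = walkVertex w (o ∸ stepLength s)

  module _ (s : OrientedEar) {b} (w : Walk (target s) b) where

    walkVertex-inside : ∀ {o} → o < stepLength s → walkVertex (s ∷ w) o ≡ stepVertex s o
    walkVertex-inside {o} o<len with o <? stepLength s
    ... | yes _   = refl
    ... | no o≮len = contradiction o<len o≮len

    walkVertex-beyond : ∀ o → walkVertex (s ∷ w) (stepLength s + o) ≡ walkVertex w o
    walkVertex-beyond o with stepLength s + o <? stepLength s
    ... | yes lt = contradiction lt (m+n≮m (stepLength s) o)
    ... | no _   = cong (walkVertex w) (m+n∸m≡n (stepLength s) o)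

    walkVertex-beyond-suc : ∀ o → walkVertex (s ∷ w) (suc (stepLength s + o)) ≡ walkVertex w (suc o)
    walkVertex-beyond-suc o = trans (cong (walkVertex (s ∷ w)) (sym (+-suc (stepLength s) o))) (walkVertex-beyond (suc o))

  walkVertex-source : ∀ {a b} (w : Walk a b) → walkVertex w 0 ≡ branch a
  walkVertex-source []      = refl
  walkVertex-source (s ∷ w) = trans (walkVertex-inside s w (len≥1 (ear s))) (stepVertex-source s)

  walkVertex-target : ∀ {a b} (w : Walk a b) → walkVertex w (walkLength w) ≡ branch b
  walkVertex-target []      = refl
  walkVertex-target (s ∷ w) = trans (walkVertex-beyond s w (walkLength w)) (walkVertex-target w)

  walkVertex-wrap : ∀ {a} (w : Walk a a) → walkVertex w (walkLength w) ≡ walkVertex w 0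
  walkVertex-wrap w = trans (walkVertex-target w) (sym (walkVertex-source w))

  walkVertex-within : ∀ s {b} (w : Walk (target s) b) {o} → o ≤ stepLength s → walkVertex (s ∷ w) o ≡ stepVertex s o
  walkVertex-within s w o≤len with m≤n⇒m<n∨m≡n o≤len
  ... | inj₁ o<len = walkVertex-inside s w o<len
  ... | inj₂ refl  = begin
    walkVertex (s ∷ w) (stepLength s)      ≡⟨ cong (walkVertex (s ∷ w)) (sym (+-identityʳ (stepLength s))) ⟩
    walkVertex (s ∷ w) (stepLength s + 0)  ≡⟨ walkVertex-beyond s w 0 ⟩
    walkVertex w 0                         ≡⟨ walkVertex-source w ⟩
    branch (target s)                      ≡⟨ sym (stepVertex-target s) ⟩
    stepVertex s (stepLength s)            ∎
    where open ≡-Reasoning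

  walkVertex-adjacent : ∀ {a b} (w : Walk a b) {o} → o < walkLength w → Adj (walkVertex w o) (walkVertex w (suc o))
  walkVertex-adjacent (s ∷ w) {o} o<len with split (stepLength s) o
  ... | inside o<L = subst₂ Adj (sym (walkVertex-inside s w o<L)) (sym (walkVertex-within s w o<L))
                                (stepVertex-adjacent s o<L)
  ... | beyond o′  = subst₂ Adj (sym (walkVertex-beyond s w o′)) (sym (walkVertex-beyond-suc s w o′))
                                (walkVertex-adjacent w (+-cancelˡ-< (stepLength s) _ _ o<len))

  OnStep : Fin n → OrientedEar → Set
  OnStep x t = ∃ λ o → o < stepLength t × x ≡ stepVertex t o

  walkVertex-onStep : ∀ {a b} (w : Walk a b) {o} → o < walkLength w → Any (OnStep (walkVertex w o)) (steps w)
  walkVertex-onStep (s ∷ w) {o} o<len with split (stepLength s) o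
  ... | inside o<L = here (o , o<L , walkVertex-inside s w o<L)
  ... | beyond o′  = there (subst (λ x → Any (OnStep x) (steps w)) (sym (walkVertex-beyond s w o′))
                                  (walkVertex-onStep w (+-cancelˡ-< (stepLength s) _ _ o<len)))

  first-step-avoids-rest : ∀ s {b} (w : Walk (target s) b) → All (Separate s) (steps w) → ∀ {p q} →
                           p < stepLength s → q < walkLength w →
                           walkVertex (s ∷ w) p ≢ walkVertex (s ∷ w) (stepLength s + q)
  first-step-avoids-rest s w separate {p} {q} p<len q<len eq =
    lookupWith {R = λ _ → ⊥}
      (λ {t} sep (o , o<len , x≡) → separate-steps-disjoint {s} {t} sep p<len o<len (trans s→x x≡))
      separate (walkVertex-onStep w q<len)
    where
    s→x : stepVertex s p ≡ walkVertex w q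
    s→x = trans (sym (walkVertex-inside s w p<len)) (trans eq (walkVertex-beyond s w q))

  walkVertex-injective : ∀ {a b} (w : Walk a b) → Simple w → ∀ {o o′} → o < walkLength w → o′ < walkLength w →
                         walkVertex w o ≡ walkVertex w o′ → o ≡ o′
  walkVertex-injective (s ∷ w) (separate ∷ simple) {o} {o′} o<len o′<len eq
    with split (stepLength s) o | split (stepLength s) o′
  ... | inside p | inside p′ = stepVertex-injective s p p′
          (trans (sym (walkVertex-inside s w p)) (trans eq (walkVertex-inside s w p′)))
  ... | inside p | beyond q′ = ⊥-elim (first-step-avoids-rest s w separate p (+-cancelˡ-< (stepLength s) _ _ o′<len) eq)
  ... | beyond q | inside p′ = ⊥-elim (first-step-avoids-rest s w separate p′ (+-cancelˡ-< (stepLength s) _ _ o<len) (sym eq))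
  ... | beyond q | beyond q′ = cong (stepLength s +_) (walkVertex-injective w simple
          (+-cancelˡ-< (stepLength s) _ _ o<len) (+-cancelˡ-< (stepLength s) _ _ o′<len)
          (trans (sym (walkVertex-beyond s w q)) (trans eq (walkVertex-beyond s w q′))))

  walkVertex-covers-edge : ∀ {a b} (w : Walk a b) {g k} → Traverses w g → k < len g → ∃ λ o → o < walkLength w ×
    SameEnds (walkVertex w o) (walkVertex w (suc o)) (vertex g k) (vertex g (suc k))
  walkVertex-covers-edge (s ∷ w) (here refl) k<len with stepVertex-covers-edge s k<len
  ... | o , o<len , same = o , ≤-trans o<len (m≤m+n _ _) ,
        SameEnds-resp (sym (walkVertex-inside s w o<len)) (sym (walkVertex-within s w o<len)) refl refl same
  walkVertex-covers-edge (s ∷ w) (there traversed) k<len with walkVertex-covers-edge w traversed k<len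
  ... | o , o<len , same = stepLength s + o , +-monoʳ-< (stepLength s) o<len ,
        SameEnds-resp (sym (walkVertex-beyond s w o)) (sym (walkVertex-beyond-suc s w o)) refl refl same

  walkVertex-onEar : ∀ {a b} (w : Walk a b) {o} → o < walkLength w →
                     ∃₂ λ e p → p ≤ len e × walkVertex w o ≡ vertex e p
  walkVertex-onEar w o<len with satisfied (walkVertex-onStep w o<len)
  ... | t , o′ , o′<len , eq = ear t , position t o′ , position-≤ t (<⇒≤ o′<len) , eq

  walkVertex-meets-ear : ∀ {a b} (w : Walk a b) {o g k} → o < walkLength w → k ≤ len g →
                         vertex g k ≡ walkVertex w o → Traverses w g ⊎ AtEnd g k
  walkVertex-meets-ear w {g = g} {k} o<len k≤len eq = meets (walkVertex-onStep w o<len) eq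
    where
    meets : ∀ {ts x} → Any (OnStep x) ts → vertex g k ≡ x → Any (λ t → ear t ≡ g) ts ⊎ AtEnd g k
    meets (here {x = t} (o , o<len , x≡)) eq with vertex-disjoint k≤len (position-≤ t (<⇒≤ o<len)) (trans eq x≡)
    ... | inj₁ (g≡ , _)  = inj₁ (here (sym g≡))
    ... | inj₂ (end , _) = inj₂ end
    meets (there any) eq = map₁ there (meets any eq)

  -- An ear of length at least 2 that the walk avoids has an inner vertex off the walk, so no edge
  -- of it joins two walk vertices.
  Chordless : ∀ {a b} → Walk a b → Set
  Chordless w = ∀ g → Traverses w g ⊎ 2 ≤ len g

  edge-between-walkVertices-traversed : ∀ {a b} (w : Walk a b) → Chordless w → ∀ {g k o o′} → k < len g →
    o < walkLength w → o′ < walkLength w → vertex g k ≡ walkVertex w o → vertex g (suc k) ≡ walkVertex w o′ →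
    Traverses w g
  edge-between-walkVertices-traversed w chordless {g} k<len o<len o′<len k↦o k+1↦o′ with chordless g
  ... | inj₁ traversed = traversed
  ... | inj₂ 2≤len with walkVertex-meets-ear w o<len (<⇒≤ k<len) k↦o | walkVertex-meets-ear w o′<len k<len k+1↦o′
  ...   | inj₁ traversed | _              = traversed
  ...   | _              | inj₁ traversed = traversed
  ...   | inj₂ end       | inj₂ end′      = ⊥-elim (no-step-between-ends 2≤len k<len end end′)

  walkVertex-next : ∀ {a} (w : Walk a a) {i j} → Consec G (walkLength w) i j →
                    walkVertex w (suc (toℕ i)) ≡ walkVertex w (toℕ j)
  walkVertex-next w (inj₁ j≡i+1)            = cong (walkVertex w) (sym j≡i+1)
  walkVertex-next w (inj₂ (i+1≡len , j≡0)) =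
    trans (cong (walkVertex w) i+1≡len) (trans (walkVertex-wrap w) (cong (walkVertex w) (sym j≡0)))

  consec-from-step : ∀ {a} (w : Walk a a) → Simple w → ∀ {o} (i j : Fin (walkLength w)) → o < walkLength w →
                     walkVertex w o ≡ walkVertex w (toℕ i) → walkVertex w (suc o) ≡ walkVertex w (toℕ j) →
                     Consec G (walkLength w) i j
  consec-from-step w simple {o} i j o<len o↦i o+1↦j = next (suc o <? walkLength w)
    where
    o≡i : o ≡ toℕ i
    o≡i = walkVertex-injective w simple o<len (toℕ<n i) o↦i
    next : Dec (suc o < walkLength w) → Consec G (walkLength w) i j
    next (yes o+1<len) = inj₁ (trans (sym (walkVertex-injective w simple o+1<len (toℕ<n j) o+1↦j)) (cong suc o≡i))
    next (no o+1≮len)  = inj₂ (trans (cong suc (sym o≡i)) o+1≡len ,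
                               sym (walkVertex-injective w simple (≤-trans (s≤s z≤n) o<len) (toℕ<n j) 0↦j))
      where
      o+1≡len : suc o ≡ walkLength w
      o+1≡len = ≤-antisym o<len (≮⇒≥ o+1≮len)
      0↦j : walkVertex w 0 ≡ walkVertex w (toℕ j)
      0↦j = trans (sym (walkVertex-wrap w)) (trans (cong (walkVertex w) (sym o+1≡len)) o+1↦j)

  -- Since H is induced, an edge between walk vertices lies on an ear, which must be traversed.
  adjacent-walkVertices-consecutive : ∀ {a} (w : Walk a a) → Simple w → Chordless w → (i j : Fin (walkLength w)) →
    Adj (walkVertex w (toℕ i)) (walkVertex w (toℕ j)) → Consec G (walkLength w) i j ⊎ Consec G (walkLength w) j i
  adjacent-walkVertices-consecutive w simple chordless i j adj
    with walkVertex-onEar w (toℕ<n i) | walkVertex-onEar w (toℕ<n j)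
  ... | e , p , p≤len , i↦p | f , q , q≤len , j↦q with vertex-induced p≤len q≤len (subst₂ Adj i↦p j↦q adj)
  ...   | g , k , k<len , edge = consecutive (walkVertex-covers-edge w traversed k<len)
    where
    edge′ : SameEnds (vertex g k) (vertex g (suc k)) (walkVertex w (toℕ i)) (walkVertex w (toℕ j))
    edge′ = SameEnds-resp refl refl (sym i↦p) (sym j↦q) edge
    traversed : Traverses w g
    traversed with edge′
    ... | inj₁ (k↦i , k+1↦j) = edge-between-walkVertices-traversed w chordless k<len (toℕ<n i) (toℕ<n j) k↦i k+1↦j
    ... | inj₂ (k↦j , k+1↦i) = edge-between-walkVertices-traversed w chordless k<len (toℕ<n j) (toℕ<n i) k↦j k+1↦i
    consecutive : (∃ λ o → o < walkLength w × SameEnds (walkVertex w o) (walkVertex w (suc o)) (vertex g k) (vertex g (suc k))) →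
                  Consec G (walkLength w) i j ⊎ Consec G (walkLength w) j i
    consecutive (o , o<len , step) with SameEnds-trans step edge′
    ... | inj₁ (o↦i , o+1↦j) = inj₁ (consec-from-step w simple i j o<len o↦i o+1↦j)
    ... | inj₂ (o↦j , o+1↦i) = inj₂ (consec-from-step w simple j i o<len o↦j o+1↦i)

  cycle : ∀ {a} (w : Walk a a) → Simple w → 3 ≤ length (steps w) → Cycle G (walkLength w)
  cycle w simple size = record
    { len≥3 = ≤-trans size (steps≤walkLength w)
    ; c     = λ i → walkVertex w (toℕ i)
    ; inj   = λ {i} {j} eq → toℕ-injective (walkVertex-injective w simple (toℕ<n i) (toℕ<n j) eq)
    ; adj   = λ i j i→j → subst (Adj _) (walkVertex-next w i→j) (walkVertex-adjacent w (toℕ<n i))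
    }

  hole : ∀ {a} (w : Walk a a) → Simple w → Chordless w → 4 ≤ length (steps w) → Hole G (walkLength w)
  hole w simple chordless size = record
    { cyc     = cycle w simple (≤-trans (n≤1+n 3) size)
    ; len≥4   = ≤-trans size (steps≤walkLength w)
    ; induced = adjacent-walkVertices-consecutive w simple chordless
    }

  faceLength : Fin 4 → ℕ
  faceLength 0F = face0
  faceLength 1F = face1
  faceLength 2F = face2
  faceLength 3F = face3

  faceLength-odd : IsOdd → ∀ v → Odd (faceLength v)
  faceLength-odd (odd₀ , _    , _    , _   ) 0F = odd₀
  faceLength-odd (_    , odd₁ , _    , _   ) 1F = odd₁
  faceLength-odd (_    , _    , odd₂ , _   ) 2F = odd₂
  faceLength-odd (_    , _    , _    , odd₃) 3F = odd₃

  faceWalk-length : ∀ v → walkLength (faceWalk v) ≡ faceLength v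
  faceWalk-length 0F = a+[b+[c+0]]≡a+b+c (len e12) (len e13) (len e23)
  faceWalk-length 1F = a+[b+[c+0]]≡a+b+c (len e02) (len e03) (len e23)
  faceWalk-length 2F = a+[b+[c+0]]≡a+b+c (len e01) (len e03) (len e13)
  faceWalk-length 3F = a+[b+[c+0]]≡a+b+c (len e01) (len e02) (len e12)

  LongEars : Matching → Set
  LongEars m = 2 ≤ len (spoke m) × 2 ≤ len (rim m)

  HasUnitEar : Matching → Set
  HasUnitEar m = ∃ λ e → e ∈ₘ m × len e ≡ 1

  unit-or-long : ∀ m → HasUnitEar m ⊎ LongEars m
  unit-or-long m with m≤n⇒m<n∨m≡n (len≥1 (spoke m)) | m≤n⇒m<n∨m≡n (len≥1 (rim m))
  ... | inj₂ 1≡len | _          = inj₁ (spoke m , inj₁ refl , sym 1≡len)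
  ... | _          | inj₂ 1≡len = inj₁ (rim m , inj₂ refl , sym 1≡len)
  ... | inj₁ 1<len | inj₁ 1<len′ = inj₂ (1<len , 1<len′)

  complement-chordless : ∀ m → LongEars m → Chordless (complement m)
  complement-chordless m (2≤spoke , 2≤rim) g with complement-covers m g
  ... | inj₁ traversed    = inj₁ traversed
  ... | inj₂ (inj₁ refl) = inj₂ 2≤spoke
  ... | inj₂ (inj₂ refl) = inj₂ 2≤rim

  -- The two faces through spoke m run once around complement m and twice along spoke m.
  complement-even : IsOdd → ∀ m → Even (walkLength (complement m))
  complement-even odd μ₁ = even-from-odd-sum {w = len e01} (faceLength-odd odd 2F) (faceLength-odd odd 3F)
                                             (identity (len e01) (len e02) (len e03) (len e12) (len e13))
    where
    identity : ∀ a01 a02 a03 a12 a13 →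
               (a01 + a03 + a13) + (a01 + a02 + a12) ≡ 2 * a01 + (a02 + (a12 + (a13 + (a03 + 0))))
    identity = solve-∀
  complement-even odd μ₂ = even-from-odd-sum {w = len e02} (faceLength-odd odd 1F) (faceLength-odd odd 3F)
                                             (identity (len e01) (len e02) (len e03) (len e12) (len e23))
    where
    identity : ∀ a01 a02 a03 a12 a23 →
               (a02 + a03 + a23) + (a01 + a02 + a12) ≡ 2 * a02 + (a01 + (a12 + (a23 + (a03 + 0))))
    identity = solve-∀
  complement-even odd μ₃ = even-from-odd-sum {w = len e03} (faceLength-odd odd 1F) (faceLength-odd odd 2F)
                                             (identity (len e01) (len e02) (len e03) (len e13) (len e23))
    where
    identity : ∀ a01 a02 a03 a13 a23 →
               (a02 + a03 + a23) + (a01 + a03 + a13) ≡ 2 * a03 + (a01 + (a13 + (a23 + (a02 + 0))))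
    identity = solve-∀

  complement-pair-length : ∀ p →
    walkLength (complement (first p)) + walkLength (complement (second p)) ≡
    faceLength 0F + faceLength (partner (third p)) + 2 * len (spoke (third p))
  complement-pair-length μ₁₂ = identity (len e01) (len e02) (len e03) (len e12) (len e13) (len e23)
    where
    identity : ∀ a01 a02 a03 a12 a13 a23 →
               (a02 + (a12 + (a13 + (a03 + 0)))) + (a01 + (a12 + (a23 + (a03 + 0)))) ≡
               (a12 + a13 + a23) + (a01 + a02 + a12) + 2 * a03
    identity = solve-∀
  complement-pair-length μ₁₃ = identity (len e01) (len e02) (len e03) (len e12) (len e13) (len e23)
    where
    identity : ∀ a01 a02 a03 a12 a13 a23 →
               (a02 + (a12 + (a13 + (a03 + 0)))) + (a01 + (a13 + (a23 + (a02 + 0)))) ≡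
               (a12 + a13 + a23) + (a01 + a03 + a13) + 2 * a02
    identity = solve-∀
  complement-pair-length μ₂₃ = identity (len e01) (len e02) (len e03) (len e12) (len e13) (len e23)
    where
    identity : ∀ a01 a02 a03 a12 a13 a23 →
               (a01 + (a12 + (a23 + (a03 + 0)))) + (a01 + (a13 + (a23 + (a02 + 0)))) ≡
               (a12 + a13 + a23) + (a02 + a03 + a23) + 2 * a01
    identity = solve-∀

-- Length bounds from the girth and the absence of long even holes

module Bounds {ℓ : ℕ} {G : Graph} (girth : HasGirth G (2 * ℓ)) (noEvenHole : NoEvenHoleFrom G (2 * ℓ + 2))
              (H : K4Subdivision G) (odd : K4Subdivision.IsOdd H) where
  open K4Subdivision H using (len; len≥1)
  open Subdivision H

  even-hole-short : ∀ {k} → Hole G k → Even k → k ≤ suc (2 * ℓ)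
  even-hole-short {k} hole-k even with 2 * ℓ + 2 ≤? k
  ... | yes long = contradiction hole-k (noEvenHole k long even)
  ... | no short = ≤-pred (subst (k <_) (+-comm (2 * ℓ) 2) (≰⇒> short))

  face-long : ∀ v → 2 * ℓ < faceLength v
  face-long v = odd∧≥⇒> {ℓ} (faceLength-odd odd v) (subst (2 * ℓ ≤_) (faceWalk-length v)
                  (proj₂ girth _ (cycle (faceWalk v) (faceWalk-simple v) (faceWalk-size v))))

  complement-short : ∀ m → LongEars m → walkLength (complement m) ≤ suc (2 * ℓ)
  complement-short m long = even-hole-short
    (hole (complement m) (complement-simple m) (complement-chordless m long) (complement-size m))
    (complement-even odd m)

  long-pair-impossible : ∀ p → LongEars (first p) → LongEars (second p) → ⊥
  long-pair-impossible p long long′ = small+small≢large+large+double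
    (complement-short (first p) long) (complement-short (second p) long′)
    (face-long 0F) (face-long (partner (third p))) (len≥1 (spoke (third p)))
    (complement-pair-length p)

lemma3p1 : (ℓ : ℕ) → 2 ≤ ℓ → (G : Graph) →
           HasGirth G (2 * ℓ) → NoEvenHoleFrom G (2 * ℓ + 2) →
           (H : K4Subdivision G) → K4Subdivision.IsOdd H →
           ∃ λ e → ∃ λ f → e ≢ f × ShareEnd e f ×
             K4Subdivision.len H e ≡ 1 × K4Subdivision.len H f ≡ 1
-- The argument does not need 2 ≤ ℓ.
lemma3p1 ℓ _ G girth noEvenHole H odd
  with pigeonhole (Subdivision.unit-or-long H) (Bounds.long-pair-impossible {ℓ} girth noEvenHole H odd)
... | p , (e , e∈ , len-e≡1) , (f , f∈ , len-f≡1) =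
  let e≢f , shareEnd = matching-ears-adjacent p e∈ f∈ in e , f , e≢f , shareEnd , len-e≡1 , len-f≡1
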